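{- There is an absolute constant $c$ such that for every $n\ge1$ and every $f\in B_n$, the TSVND circuit complexity of $f$ is at most $c\cdot|\mathcal{T}(f)|$, where $|\mathcal{T}(f)|$ is the size of a minimal $Pol$ cover for $f$ (i.e. $f$ has TSVND circuit complexity $O(|\mathcal{T}(f)|)$).
   Context: $B_k$ is the set of Boolean functions $\{0,1\}^k\to\{0,1\}$. Enumerate $\{0,1\}^n$ lexicographically as $a^1,\dots,a^{2^n}$; the truth table $f^{\bullet}$ is the $2^n\times(n+1)$ matrix with rows $(a^j,f(a^j))$. Vectors in $\{0,1\}^{2^n}$ are called columns; the columns of $f^{\bullet}$ are $x_1,\dots,x_n$ ($x_i[j]=a^j_i$) and the result column $r$ ($r[j]=f(a^j)$). For $w\in B_{2^n}$ and a column $v$, $w(v)=w(v[1],\dots,v[2^n])$. $\overline{Pol}(f^{\bullet})$ is the set of $w\in B_{2^n}$ with $w(r)\ne f(w(x_1),\dots,w(x_n))$, i.e. $(w(x_1),\dots,w(x_n),w(r))$ is not a row of $f^{\bullet}$. An $\land$-gate is a triple $(u,v,z)$ of columns with $z=u\land v$ componentwise, an $\lor$-gate a triple with $z=u\lor v$, a $\neg$-gate a pair $(u,z)$ with $z=\neg u$. Such a gate covers $w\in B_{2^n}$ if $w(z)\ne w(u)\land w(v)$ (resp. $w(z)\neq w(u)\lor w(v)$, resp. $w(z)\ne\neg w(u)$). A $Pol$ cover for $f$ is a collection of gates such that every $w\in\overline{Pol}(f^{\bullet})$ is covered by at least one gate of the collection; $|\mathcal{T}(f)|$ is the minimum number of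 gates in a $Pol$ cover for $f$. A TSVND circuit is a circuit (fan-in two $\land$, $\lor$, and $\neg$ gates) $C(x,y)$ with ordinary inputs $x\in\{0,1\}^n$, non-deterministic inputs $y\in\{0,1\}^m$, and three possible outputs $0,1,quit$, such that for each $x$ there are no $y,y'$ with $C(x,y)=1$, $C(x,y')=0$, and for each $x$ some $y$ has $C(x,y)\in\{0,1\}$; $C$ computes $f$ if for every $x$ the value $b\in\{0,1\}$ attained as $C(x,y)$ for some $y$ equals $f(x)$. TSVND circuit complexity is the minimum number of gates of a TSVND circuit computing $f$. -}

module Defs where

open import Data.Bool using (Bool; true; false; _∧_; _∨_; not)
open import Data.Nat using (ℕ; zero; suc; _+_; _*_; _^_; _≤_)
open import Data.Fin using (Fin)
open import Data.Vec using (Vec; []; _∷_; _++_; map; lookup; tabulate; zipWith)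
open import Data.Maybe using (Maybe; just; nothing)
open import Data.Sum using (_⊎_; inj₁; inj₂)
open import Data.Product using (Σ; ∃; _×_; _,_)
open import Data.List using (List; length)
open import Data.List.Relation.Unary.Any using (Any)
open import Relation.Binary.PropositionalEquality using (_≡_; _≢_)
open import Relation.Nullary using (¬_)

BoolFun : ℕ → Set
BoolFun k = Vec Bool k → Bool

-- Lexicographic enumeration a^1,…,a^{2^n} of {0,1}^n
-- (false < true, first coordinate most significant)

enum : (n : ℕ) → Vec (Vec Bool n) (2 ^ n)
enum zero    = [] ∷ []
enum (suc n) = map (false ∷_) (enum n) ++ (map (true ∷_) (enum n) ++ [])

Column : ℕ → Set
Column n = Vec Bool (2 ^ n)

xCol : (n : ℕ) → Fin n → Column n
xCol n i = map (λ a → lookup a i) (enum n)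

rCol : (n : ℕ) → BoolFun n → Column n
rCol n f = map f (enum n)

InPolBar : (n : ℕ) → BoolFun n → BoolFun (2 ^ n) → Set
InPolBar n f w = w (rCol n f) ≢ f (tabulate (λ i → w (xCol n i)))

data PolGate (n : ℕ) : Set where
  andG : (u v z : Column n) → z ≡ zipWith _∧_ u v → PolGate n
  orG  : (u v z : Column n) → z ≡ zipWith _∨_ u v → PolGate n
  notG : (u z : Column n) → z ≡ map not u → PolGate n

Covers : {n : ℕ} → PolGate n → BoolFun (2 ^ n) → Set
Covers (andG u v z _) w = w z ≢ (w u ∧ w v)
Covers (orG u v z _)  w = w z ≢ (w u ∨ w v)
Covers (notG u z _)   w = w z ≢ not (w u)

IsPolCover : (n : ℕ) → BoolFun n → List (PolGate n) → Set
IsPolCover n f T = (w : BoolFun (2 ^ n)) → InPolBar n f w → Any (λ g → Covers g w) T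

-- Circuits with fan-in two ∧, ∨ and ¬ gates.
-- A circuit over k inputs with s gates; a wire is an input (Fin k) or an
-- earlier gate (Fin s, index zero = the most recent earlier gate).

Wire : ℕ → ℕ → Set
Wire k s = Fin k ⊎ Fin s

data CGate (k s : ℕ) : Set where
  cand : Wire k s → Wire k s → CGate k s
  cor  : Wire k s → Wire k s → CGate k s
  cnot : Wire k s → CGate k s

data Circuit (k : ℕ) : ℕ → Set where
  []  : Circuit k 0
  _▷_ : {s : ℕ} → Circuit k s → CGate k s → Circuit k (suc s)

wireVal : {k s : ℕ} → (Fin k → Bool) → Vec Bool s → Wire k s → Bool
wireVal inp gs (inj₁ i) = inp i
wireVal inp gs (inj₂ j) = lookup gs j

gateVal : {k s : ℕ} → (Fin k → Bool) → Vec Bool s → CGate k s → Bool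
gateVal inp gs (cand a b) = wireVal inp gs a ∧ wireVal inp gs b
gateVal inp gs (cor a b)  = wireVal inp gs a ∨ wireVal inp gs b
gateVal inp gs (cnot a)   = not (wireVal inp gs a)

evalGates : {k s : ℕ} → Circuit k s → (Fin k → Bool) → Vec Bool s
evalGates []      inp = []
evalGates (C ▷ g) inp = let gs = evalGates C inp in gateVal inp gs g ∷ gs

-- Circuits with ordinary inputs x ∈ {0,1}^n, non-deterministic inputs
-- y ∈ {0,1}^m and outputs 0, 1, quit. The output is read from two
-- designated wires: a "defined" wire d and a value wire o;
-- C(x,y) = quit (nothing) if d = 0, and C(x,y) = o (just o) otherwise.

record NDCircuit (n : ℕ) : Set where
  field
    m       : ℕ
    size    : ℕ
    circ    : Circuit (n + m) size
    outVal  : Wire (n + m) size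
    outDef  : Wire (n + m) size

run : {n : ℕ} → (C : NDCircuit n) → Vec Bool n → Vec Bool (NDCircuit.m C) → Maybe Bool
run C x y with wireVal inp gs (NDCircuit.outDef C)
  where
    inp = λ i → lookup (x ++ y) i
    gs  = evalGates (NDCircuit.circ C) inp
... | false = nothing
... | true  = just (wireVal (λ i → lookup (x ++ y) i)
                            (evalGates (NDCircuit.circ C) (λ i → lookup (x ++ y) i))
                            (NDCircuit.outVal C))

IsTSVND : {n : ℕ} → NDCircuit n → Set
IsTSVND {n} C = (x : Vec Bool n) →
    ¬ (Σ (Vec Bool (NDCircuit.m C)) λ y → Σ (Vec Bool (NDCircuit.m C)) λ y' →
         (run C x y ≡ just true) × (run C x y' ≡ just false))
  × Σ (Vec Bool (NDCircuit.m C)) (λ y → run C x y ≢ nothing)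

Computes : {n : ℕ} → NDCircuit n → BoolFun n → Set
Computes {n} C f = (x : Vec Bool n) (y : Vec Bool (NDCircuit.m C)) (b : Bool) →
  run C x y ≡ just b → b ≡ f x

-- Guess w ∈ B_{2^n} nondeterministically, one bit per column, except that each input column x_i
-- is hard-wired to the input x_i. Seven gates per gate of T check that the gate does not cover w;
-- if no gate covers w, then w ∉ Pol̄(f•) since T is a cover, so the output w(r) equals
-- f(w(x_1),…,w(x_n)) = f(x). The projection w(v) = v[j] onto the row a^j = x is covered by no
-- gate at all, because gates are componentwise, so some guess passes every check.

module Submission where

open import Defs
open import Data.Nat using (ℕ; zero; suc; _+_; _*_; _^_; _≤_)
open import Data.Nat.Properties using (≤-reflexive; *-comm)
open import Data.Bool using (Bool; true; false; _∧_; _∨_; not)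
import Data.Bool as Bool
open import Data.Bool.Properties using (T-≡; ∧-conicalˡ; ∧-conicalʳ)
open import Data.Fin using (Fin; _↑ˡ_; _↑ʳ_; _≟_)
import Data.Fin as Fin
open import Data.Fin.Properties using (any?)
open import Data.Vec using (Vec; []; _∷_; _++_; map; lookup; tabulate; zipWith)
open import Data.Vec.Properties
  using (lookup-map; lookup-zipWith; lookup-++ˡ; lookup-++ʳ; lookup∘tabulate; tabulate∘lookup; tabulate-cong; ≡-dec)
open import Data.Maybe using (just; nothing)
open import Data.Sum using (inj₁; inj₂; map₂)
open import Data.Product using (Σ; _×_; _,_)
open import Data.List using (List; []; _∷_; length)
open import Data.List.Relation.Unary.Any using (Any; here; there)
open import Data.Empty using (⊥-elim)
open import Function using (_∘_; case_of_)
open import Function.Bundles using (Equivalence)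
open import Relation.Nullary using (¬_; yes; no; does)
open import Relation.Nullary.Decidable using (isYes; isYes≗does; toWitness; dec-true; decidable-stable)
open import Relation.Binary.PropositionalEquality
open ≡-Reasoning

enumIndex : (k : ℕ) → Vec Bool k → Fin (2 ^ k)
enumIndex zero    []          = Fin.zero
enumIndex (suc k) (false ∷ a) = enumIndex k a ↑ˡ (2 ^ k + 0)
enumIndex (suc k) (true ∷ a)  = 2 ^ k ↑ʳ (enumIndex k a ↑ˡ 0)

lookup-enum-enumIndex : (k : ℕ) (a : Vec Bool k) → lookup (enum k) (enumIndex k a) ≡ a
lookup-enum-enumIndex zero [] = refl
lookup-enum-enumIndex (suc k) (false ∷ a) = begin
  lookup (map (false ∷_) (enum k) ++ _) (enumIndex k a ↑ˡ _)
    ≡⟨ lookup-++ˡ (map (false ∷_) (enum k)) _ (enumIndex k a) ⟩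
  lookup (map (false ∷_) (enum k)) (enumIndex k a)
    ≡⟨ lookup-map (enumIndex k a) (false ∷_) (enum k) ⟩
  false ∷ lookup (enum k) (enumIndex k a)
    ≡⟨ cong (false ∷_) (lookup-enum-enumIndex k a) ⟩
  false ∷ a ∎
lookup-enum-enumIndex (suc k) (true ∷ a) = begin
  lookup (map (false ∷_) (enum k) ++ (map (true ∷_) (enum k) ++ [])) (2 ^ k ↑ʳ (enumIndex k a ↑ˡ 0))
    ≡⟨ lookup-++ʳ (map (false ∷_) (enum k)) _ (enumIndex k a ↑ˡ 0) ⟩
  lookup (map (true ∷_) (enum k) ++ []) (enumIndex k a ↑ˡ 0)
    ≡⟨ lookup-++ˡ (map (true ∷_) (enum k)) [] (enumIndex k a) ⟩
  lookup (map (true ∷_) (enum k)) (enumIndex k a)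
    ≡⟨ lookup-map (enumIndex k a) (true ∷_) (enum k) ⟩
  true ∷ lookup (enum k) (enumIndex k a)
    ≡⟨ cong (true ∷_) (lookup-enum-enumIndex k a) ⟩
  true ∷ a ∎

lookup-xCol-enumIndex : (n : ℕ) (i : Fin n) (a : Vec Bool n) →
                        lookup (xCol n i) (enumIndex n a) ≡ lookup a i
lookup-xCol-enumIndex n i a = begin
  lookup (xCol n i) (enumIndex n a)           ≡⟨ lookup-map (enumIndex n a) (λ b → lookup b i) (enum n) ⟩
  lookup (lookup (enum n) (enumIndex n a)) i  ≡⟨ cong (λ b → lookup b i) (lookup-enum-enumIndex n a) ⟩
  lookup a i                                  ∎

xCol-injective : (n : ℕ) {i j : Fin n} → xCol n i ≡ xCol n j → i ≡ j
xCol-injective n {i} {j} xᵢ≡xⱼ = toWitness (Equivalence.from T-≡ i≟j-holds)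
  where
  indicator : Vec Bool n
  indicator = tabulate (λ k → isYes (k ≟ j))

  row : Fin (2 ^ n)
  row = enumIndex n indicator

  i≟j-holds : isYes (i ≟ j) ≡ true
  i≟j-holds = begin
    isYes (i ≟ j)          ≡⟨ lookup∘tabulate _ i ⟨
    lookup indicator i     ≡⟨ lookup-xCol-enumIndex n i indicator ⟨
    lookup (xCol n i) row  ≡⟨ cong (λ c → lookup c row) xᵢ≡xⱼ ⟩
    lookup (xCol n j) row  ≡⟨ lookup-xCol-enumIndex n j indicator ⟩
    lookup indicator j     ≡⟨ lookup∘tabulate _ j ⟩
    isYes (j ≟ j)          ≡⟨ isYes≗does (j ≟ j) ⟩
    does (j ≟ j)           ≡⟨ dec-true (j ≟ j) refl ⟩
    true                   ∎

_≡ᵇ_ : Bool → Bool → Bool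
a ≡ᵇ b = (a ∧ b) ∨ (not a ∧ not b)

≡ᵇ⇒≡ : (a b : Bool) → a ≡ᵇ b ≡ true → a ≡ b
≡ᵇ⇒≡ true  true  _ = refl
≡ᵇ⇒≡ false false _ = refl

≡⇒≡ᵇ : {a b : Bool} → a ≡ b → a ≡ᵇ b ≡ true
≡⇒≡ᵇ {true}  refl = refl
≡⇒≡ᵇ {false} refl = refl

module _ {n : ℕ} where

  satisfiesᵇ : BoolFun (2 ^ n) → PolGate n → Bool
  satisfiesᵇ w (andG u v z _) = w z ≡ᵇ (w u ∧ w v)
  satisfiesᵇ w (orG u v z _)  = w z ≡ᵇ (w u ∨ w v)
  satisfiesᵇ w (notG u z _)   = w z ≡ᵇ not (w u)

  satisfiesᵇ⇒¬Covers : (w : BoolFun (2 ^ n)) (g : PolGate n) → satisfiesᵇ w g ≡ true → ¬ Covers g w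
  satisfiesᵇ⇒¬Covers w (andG _ _ _ _) ok = λ covered → covered (≡ᵇ⇒≡ _ _ ok)
  satisfiesᵇ⇒¬Covers w (orG _ _ _ _)  ok = λ covered → covered (≡ᵇ⇒≡ _ _ ok)
  satisfiesᵇ⇒¬Covers w (notG _ _ _)   ok = λ covered → covered (≡ᵇ⇒≡ _ _ ok)

  projection-satisfiesᵇ : (j : Fin (2 ^ n)) {w : BoolFun (2 ^ n)} → (∀ v → w v ≡ lookup v j) →
                          (g : PolGate n) → satisfiesᵇ w g ≡ true
  projection-satisfiesᵇ j {w} w≗proj (andG u v _ refl) = ≡⇒≡ᵇ (begin
    w (zipWith _∧_ u v)          ≡⟨ w≗proj _ ⟩
    lookup (zipWith _∧_ u v) j   ≡⟨ lookup-zipWith _∧_ j u v ⟩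
    lookup u j ∧ lookup v j      ≡⟨ cong₂ _∧_ (w≗proj u) (w≗proj v) ⟨
    w u ∧ w v                    ∎)
  projection-satisfiesᵇ j {w} w≗proj (orG u v _ refl) = ≡⇒≡ᵇ (begin
    w (zipWith _∨_ u v)          ≡⟨ w≗proj _ ⟩
    lookup (zipWith _∨_ u v) j   ≡⟨ lookup-zipWith _∨_ j u v ⟩
    lookup u j ∨ lookup v j      ≡⟨ cong₂ _∨_ (w≗proj u) (w≗proj v) ⟨
    w u ∨ w v                    ∎)
  projection-satisfiesᵇ j {w} w≗proj (notG u _ refl) = ≡⇒≡ᵇ (begin
    w (map not u)          ≡⟨ w≗proj _ ⟩
    lookup (map not u) j   ≡⟨ lookup-map j not u ⟩
    not (lookup u j)       ≡⟨ cong not (w≗proj u) ⟨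
    not (w u)              ∎)

  allSatisfiedᵇ : Bool → BoolFun (2 ^ n) → List (PolGate n) → Bool
  allSatisfiedᵇ b w []      = b
  allSatisfiedᵇ b w (g ∷ T) = allSatisfiedᵇ b w T ∧ satisfiesᵇ w g

  allSatisfiedᵇ⇒uncovered : (b : Bool) (w : BoolFun (2 ^ n)) (T : List (PolGate n)) →
                            allSatisfiedᵇ b w T ≡ true → ¬ Any (λ g → Covers g w) T
  allSatisfiedᵇ⇒uncovered b w (g ∷ T) ok (here covered) =
    satisfiesᵇ⇒¬Covers w g (∧-conicalʳ _ _ ok) covered
  allSatisfiedᵇ⇒uncovered b w (g ∷ T) ok (there covered) =
    allSatisfiedᵇ⇒uncovered b w T (∧-conicalˡ _ _ ok) covered

  projection-allSatisfiedᵇ : (j : Fin (2 ^ n)) {w : BoolFun (2 ^ n)} → (∀ v → w v ≡ lookup v j) →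
                             (T : List (PolGate n)) → allSatisfiedᵇ true w T ≡ true
  projection-allSatisfiedᵇ j w≗proj []      = refl
  projection-allSatisfiedᵇ j w≗proj (g ∷ T) =
    cong₂ _∧_ (projection-allSatisfiedᵇ j w≗proj T) (projection-satisfiesᵇ j w≗proj g)

  uncovered⇒preserves : (f : BoolFun n) (T : List (PolGate n)) → IsPolCover n f T →
                        (w : BoolFun (2 ^ n)) → ¬ Any (λ g → Covers g w) T →
                        w (rCol n f) ≡ f (tabulate (λ i → w (xCol n i)))
  uncovered⇒preserves f T cover w uncovered =
    decidable-stable (_ Bool.≟ _) (λ w∈Pol̄ → uncovered (cover w w∈Pol̄))

weaken : {k s : ℕ} (t : ℕ) → Wire k s → Wire k (t + s)
weaken t = map₂ (t ↑ʳ_)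

wireVal-weaken : {k s t : ℕ} (inp : Fin k → Bool) (new : Vec Bool t) (gs : Vec Bool s) (w : Wire k s) →
                 wireVal inp (new ++ gs) (weaken t w) ≡ wireVal inp gs w
wireVal-weaken inp new gs (inj₁ i) = refl
wireVal-weaken inp new gs (inj₂ j) = lookup-++ʳ new gs j

-- Gates, oldest first: g, z ∧ g, ¬z, ¬g, ¬z ∧ ¬g, z ≡ᵇ g, acc ∧ (z ≡ᵇ g).
appendCheck : {k s : ℕ} → Circuit k s → Wire k s → CGate k s → Fin k → Circuit k (7 + s)
appendCheck C acc g z =
  ((((((C ▷ g)
    ▷ cand (inj₁ z) (inj₂ Fin.zero))
    ▷ cnot (inj₁ z))
    ▷ cnot (inj₂ (Fin.suc (Fin.suc Fin.zero))))
    ▷ cand (inj₂ (Fin.suc Fin.zero)) (inj₂ Fin.zero))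
    ▷ cor (inj₂ (Fin.suc (Fin.suc (Fin.suc Fin.zero)))) (inj₂ Fin.zero))
    ▷ cand (weaken 6 acc) (inj₂ Fin.zero)

appendCheck-value : {k s : ℕ} (C : Circuit k s) (acc : Wire k s) (g : CGate k s) (z : Fin k)
                    (inp : Fin k → Bool) →
                    wireVal inp (evalGates (appendCheck C acc g z) inp) (inj₂ Fin.zero)
                      ≡ wireVal inp (evalGates C inp) acc ∧ (inp z ≡ᵇ gateVal inp (evalGates C inp) g)
appendCheck-value C acc g z inp =
  cong (_∧ (inp z ≡ᵇ gateVal inp (evalGates C inp) g)) (wireVal-weaken inp (_ ∷ _ ∷ _ ∷ _ ∷ _ ∷ _ ∷ []) _ acc)

module _ {n : ℕ} (C : NDCircuit n) (x : Vec Bool n) (y : Vec Bool (NDCircuit.m C)) where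
  open NDCircuit C

  wireAt : Wire (n + m) size → Bool
  wireAt = wireVal (lookup (x ++ y)) (evalGates circ (lookup (x ++ y)))

  run≡just : {b : Bool} → run C x y ≡ just b → wireAt outDef ≡ true × wireAt outVal ≡ b
  run≡just _ with wireAt outDef
  run≡just refl | true = refl , refl

  run≢nothing : wireAt outDef ≡ true → run C x y ≢ nothing
  run≢nothing _ with wireAt outDef
  run≢nothing refl | true = λ ()

Computes⇒unambiguous : {n : ℕ} {C : NDCircuit n} {f : BoolFun n} → Computes C f → (x : Vec Bool n) →
    ¬ (Σ (Vec Bool (NDCircuit.m C)) λ y → Σ (Vec Bool (NDCircuit.m C)) λ y' →
         (run C x y ≡ just true) × (run C x y' ≡ just false))
Computes⇒unambiguous computes x (y , y' , gives-true , gives-false) =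
  case trans (computes x y true gives-true) (sym (computes x y' false gives-false)) of λ ()

-- Guess bit 0 seeds the accumulator (circuits have no constant gates, and T may be empty);
-- guess bit 1 + j is the guessed value w(v) of the column v with index j in enum (2 ^ n).
module GuessAndCheck (n : ℕ) where

  guessBits : ℕ
  guessBits = suc (2 ^ (2 ^ n))

  Input : Set
  Input = Fin (n + guessBits)

  seedBit : Input
  seedBit = n ↑ʳ Fin.zero

  columnInput : Column n → Input
  columnInput v with any? (λ i → ≡-dec Bool._≟_ (xCol n i) v)
  ... | yes (i , _) = i ↑ˡ guessBits
  ... | no _        = n ↑ʳ Fin.suc (enumIndex (2 ^ n) v)

  simulate : {s : ℕ} → PolGate n → CGate (n + guessBits) s
  simulate (andG u v _ _) = cand (inj₁ (columnInput u)) (inj₁ (columnInput v))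
  simulate (orG u v _ _)  = cor (inj₁ (columnInput u)) (inj₁ (columnInput v))
  simulate (notG u _ _)   = cnot (inj₁ (columnInput u))

  result : PolGate n → Input
  result (andG _ _ z _) = columnInput z
  result (orG _ _ z _)  = columnInput z
  result (notG _ z _)   = columnInput z

  checkResult : {s : ℕ} (inp : Input → Bool) (gs : Vec Bool s) (g : PolGate n) →
                (inp (result g) ≡ᵇ gateVal inp gs (simulate g)) ≡ satisfiesᵇ (inp ∘ columnInput) g
  checkResult inp gs (andG _ _ _ _) = refl
  checkResult inp gs (orG _ _ _ _)  = refl
  checkResult inp gs (notG _ _ _)   = refl

  checker : (T : List (PolGate n)) → Circuit (n + guessBits) (length T * 7)
  checkerOut : (T : List (PolGate n)) → Wire (n + guessBits) (length T * 7)
  checker []      = []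
  checker (g ∷ T) = appendCheck (checker T) (checkerOut T) (simulate g) (result g)
  checkerOut []      = inj₁ seedBit
  checkerOut (_ ∷ _) = inj₂ Fin.zero

  checkerOut-value : (inp : Input → Bool) (T : List (PolGate n)) →
                     wireVal inp (evalGates (checker T) inp) (checkerOut T)
                       ≡ allSatisfiedᵇ (inp seedBit) (inp ∘ columnInput) T
  checkerOut-value inp []      = refl
  checkerOut-value inp (g ∷ T) = begin
    wireVal inp (evalGates (checker (g ∷ T)) inp) (inj₂ Fin.zero)
      ≡⟨ appendCheck-value (checker T) (checkerOut T) (simulate g) (result g) inp ⟩
    wireVal inp (evalGates (checker T) inp) (checkerOut T) ∧ (inp (result g) ≡ᵇ gateVal inp _ (simulate g))
      ≡⟨ cong₂ _∧_ (checkerOut-value inp T) (checkResult inp _ g) ⟩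
    allSatisfiedᵇ (inp seedBit) (inp ∘ columnInput) T ∧ satisfiesᵇ (inp ∘ columnInput) g ∎

  guessCircuit : BoolFun n → List (PolGate n) → NDCircuit n
  guessCircuit f T = record
    { m      = guessBits
    ; size   = length T * 7
    ; circ   = checker T
    ; outVal = inj₁ (columnInput (rCol n f))
    ; outDef = checkerOut T
    }

  guessed : Vec Bool n → Vec Bool guessBits → BoolFun (2 ^ n)
  guessed x y = lookup (x ++ y) ∘ columnInput

  guessed-xCol : (x : Vec Bool n) (y : Vec Bool guessBits) (i : Fin n) → guessed x y (xCol n i) ≡ lookup x i
  guessed-xCol x y i with any? (λ i′ → ≡-dec Bool._≟_ (xCol n i′) (xCol n i))
  ... | yes (i′ , xᵢ′≡xᵢ) = trans (lookup-++ˡ x y i′) (cong (lookup x) (xCol-injective n xᵢ′≡xᵢ))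
  ... | no  ¬∃            = ⊥-elim (¬∃ (i , refl))

  honestGuess : Vec Bool n → Vec Bool guessBits
  honestGuess x = true ∷ map (λ v → lookup v (enumIndex n x)) (enum (2 ^ n))

  guessed-honestGuess : (x : Vec Bool n) (v : Column n) →
                        guessed x (honestGuess x) v ≡ lookup v (enumIndex n x)
  guessed-honestGuess x v with any? (λ i → ≡-dec Bool._≟_ (xCol n i) v)
  ... | yes (i , refl) = trans (lookup-++ˡ x (honestGuess x) i) (sym (lookup-xCol-enumIndex n i x))
  ... | no  _          = begin
    lookup (x ++ honestGuess x) (n ↑ʳ Fin.suc (enumIndex (2 ^ n) v))
      ≡⟨ lookup-++ʳ x (honestGuess x) (Fin.suc (enumIndex (2 ^ n) v)) ⟩
    lookup (map (λ c → lookup c (enumIndex n x)) (enum (2 ^ n))) (enumIndex (2 ^ n) v)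
      ≡⟨ lookup-map (enumIndex (2 ^ n) v) (λ c → lookup c (enumIndex n x)) (enum (2 ^ n)) ⟩
    lookup (lookup (enum (2 ^ n)) (enumIndex (2 ^ n) v)) (enumIndex n x)
      ≡⟨ cong (λ c → lookup c (enumIndex n x)) (lookup-enum-enumIndex (2 ^ n) v) ⟩
    lookup v (enumIndex n x) ∎

  guessCircuit-computes : (f : BoolFun n) (T : List (PolGate n)) → IsPolCover n f T →
                          Computes (guessCircuit f T) f
  guessCircuit-computes f T cover x y b runs with run≡just (guessCircuit f T) x y runs
  ... | passes , output≡b = begin
    b                                                    ≡⟨ output≡b ⟨
    guessed x y (rCol n f)                               ≡⟨ uncovered⇒preserves f T cover (guessed x y) uncovered ⟩
    f (tabulate (λ i → guessed x y (xCol n i)))          ≡⟨ cong f (tabulate-cong (guessed-xCol x y)) ⟩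
    f (tabulate (lookup x))                              ≡⟨ cong f (tabulate∘lookup x) ⟩
    f x                                                  ∎
    where
    uncovered : ¬ Any (λ g → Covers g (guessed x y)) T
    uncovered = allSatisfiedᵇ⇒uncovered _ (guessed x y) T
                  (trans (sym (checkerOut-value (lookup (x ++ y)) T)) passes)

  guessCircuit-total : (f : BoolFun n) (T : List (PolGate n)) (x : Vec Bool n) →
                       run (guessCircuit f T) x (honestGuess x) ≢ nothing
  guessCircuit-total f T x = run≢nothing (guessCircuit f T) x (honestGuess x) (begin
    wireVal (lookup (x ++ honestGuess x)) (evalGates (checker T) (lookup (x ++ honestGuess x))) (checkerOut T)
      ≡⟨ checkerOut-value (lookup (x ++ honestGuess x)) T ⟩
    allSatisfiedᵇ (lookup (x ++ honestGuess x) seedBit) (guessed x (honestGuess x)) T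
      ≡⟨ cong (λ b → allSatisfiedᵇ b (guessed x (honestGuess x)) T) (lookup-++ʳ x (honestGuess x) Fin.zero) ⟩
    allSatisfiedᵇ true (guessed x (honestGuess x)) T
      ≡⟨ projection-allSatisfiedᵇ (enumIndex n x) (guessed-honestGuess x) T ⟩
    true ∎)

mainTheorem7 : Σ ℕ λ c → (n : ℕ) → 1 ≤ n → (f : BoolFun n) →
    (T : List (PolGate n)) → IsPolCover n f T →
    Σ (NDCircuit n) λ C → IsTSVND C × Computes C f
    × NDCircuit.size C ≤ c * length T
mainTheorem7 = 7 , λ n _ f T cover →
  let open GuessAndCheck n
      computes = guessCircuit-computes f T cover
  in guessCircuit f T
   , (λ x → Computes⇒unambiguous computes x , honestGuess x , guessCircuit-total f T x)
   , computes
   , ≤-reflexive (*-comm (length T) 7)
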